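{- For $2\le k\le n-2$, $$q_m(P_n^2,k)=\begin{cases} z_{k,n}, & m=k,\\ n-k, & m=k+1,\\ 0, & m\ge k+2,\end{cases}$$ where $z_{k,n}=\sum_{j=0}^{\min\{k-1,n-k\}}\binom{k-1}{j}(n-k-j+1)$.
   Context: The squared path $P_n^2$ is the graph on $[n]=\{1,\dots,n\}$ whose edges are the pairs $\{i,i+1\}$ ($1\le i\le n-1$) and $\{i,i+2\}$ ($1\le i\le n-2$). For a graph $G$ on $[n]$, a subset $C\subseteq[n]$ is called $k$-bad if $|C|\ge k$ and every $k$-element subset of $C$ induces a connected subgraph of $G$. $q_m(G,k)$ denotes the number of $k$-bad subsets $C\subseteq[n]$ with $|C|=m$. -}

module Defs where

open import Data.Nat using (ℕ; suc; _+_; _*_; _∸_; _⊓_; _≤_)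
open import Data.Nat.Combinatorics using (_C_)
open import Data.Fin using (Fin; toℕ)
open import Data.Fin.Subset using (Subset; _∈_; _⊆_; ∣_∣)
open import Data.List using (List; length; map; upTo)
open import Data.Nat.ListAction using (sum)
open import Data.List.Relation.Unary.Unique.Propositional using (Unique)
import Data.List.Membership.Propositional as LM
open import Data.Product using (Σ; _×_)
open import Data.Sum using (_⊎_)
open import Function.Bundles using (_⇔_)
open import Relation.Binary.PropositionalEquality using (_≡_)

-- Vertex i : Fin n stands for the vertex (toℕ i + 1) of [n].

SqPathAdj : {n : ℕ} → Fin n → Fin n → Set
SqPathAdj i j =
  (toℕ j ≡ toℕ i + 1) ⊎ (toℕ j ≡ toℕ i + 2) ⊎
  (toℕ i ≡ toℕ j + 1) ⊎ (toℕ i ≡ toℕ j + 2)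

Graph : ℕ → Set₁
Graph n = Fin n → Fin n → Set

data Reach {n : ℕ} (G : Graph n) (S : Subset n) (u : Fin n) : Fin n → Set where
  here : u ∈ S → Reach G S u u
  step : ∀ {v w} → Reach G S u v → G v w → w ∈ S → Reach G S u w

InducedConnected : {n : ℕ} → Graph n → Subset n → Set
InducedConnected G S = ∀ u v → u ∈ S → v ∈ S → Reach G S u v

KBad : {n : ℕ} → Graph n → ℕ → Subset n → Set
KBad G k C = (k ≤ ∣ C ∣) × (∀ D → D ⊆ C → ∣ D ∣ ≡ k → InducedConnected G D)

HasCount : {n : ℕ} → (Subset n → Set) → ℕ → Set
HasCount {n} P q =
  Σ (List (Subset n)) λ xs → Unique xs × (length xs ≡ q) × (∀ C → (C LM.∈ xs) ⇔ P C)

QCount : {n : ℕ} → Graph n → ℕ → ℕ → ℕ → Set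
QCount G k m q = HasCount (λ C → KBad G k C × (∣ C ∣ ≡ m)) q

z : ℕ → ℕ → ℕ
z k n = sum (map (λ j → ((k ∸ 1) C j) * (n ∸ k ∸ j + 1)) (upTo (suc ((k ∸ 1) ⊓ (n ∸ k)))))

module Submission where

-- A set S ⊆ [n] induces a connected subgraph of P_n² iff it has no double hole, i.e. no two
-- consecutive non-members strictly between two members: edges have length at most 2, so no path
-- crosses such a gap, and otherwise every member other than the least has a member 1 or 2 below it.
-- Hence the connected k-sets are the walks that start at some s and take k − 1 steps of length
-- 1 or 2; with j steps of length 2 the walk covers k + j positions, leaving
-- binom(k−1, j) (n − k − j + 1) choices, and summing over j gives z_{k,n}.
--
-- A k-bad (k+1)-set C (k ≥ 2) has no double hole, as deleting a third member would leave a
-- disconnected k-set.  Nor has it a single hole b: both neighbours of b would be members, and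
-- deleting the one on the side away from a third member creates a double hole.  So C is an
-- interval; conversely every k-subset of a (k+1)-interval misses one point and is connected,
-- so there are n − k such sets.  Finally a k-bad set with at least k + 2 elements has a k-bad
-- subset of size k + 2, and deleting the middle one of three of its members leaves a k-bad
-- (k+1)-set with a hole.

open import Data.Bool using (Bool; true; false)
open import Data.Empty using (⊥-elim)
open import Data.Fin as Fin using (Fin; toℕ; fromℕ<)
open import Data.Fin.Properties using (toℕ-fromℕ<; toℕ-injective)
open import Data.Fin.Subset using (Subset; _∈_; _⊆_; ∣_∣; ⊥)
open import Data.Fin.Subset.Properties using (p⊆q⇒∣p∣≤∣q∣; drop-∷-⊆; s⊆s; ⊥⊆; ∣⊥∣≡0)
open import Data.List using (List; []; _∷_; _++_; length; map; replicate; concatMap; upTo)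
open import Data.List.Properties as List using (length-map; length-++; length-upTo; length-replicate)
open import Data.List.Membership.Propositional using (find; lose) renaming (_∈_ to _∈ₗ_)
open import Data.List.Membership.Propositional.Properties
  using (∈-upTo⁺; ∈-upTo⁻; ∈-map⁺; ∈-map⁻; ∈-++⁺ˡ; ∈-++⁺ʳ; ∈-++⁻; ∈-concatMap⁺; ∈-concatMap⁻)
open import Data.List.Relation.Binary.Disjoint.Propositional using (Disjoint)
open import Data.List.Relation.Unary.All as All using ()
import Data.List.Relation.Unary.All.Properties as All
open import Data.List.Relation.Unary.AllPairs as AllPairs using ([]; _∷_)
import Data.List.Relation.Unary.AllPairs.Properties as AllPairs
open import Data.List.Relation.Unary.Any using (here; there)
open import Data.List.Relation.Unary.Unique.Propositional using (Unique)
import Data.List.Relation.Unary.Unique.Propositional.Properties as Unique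
open import Data.Nat
open import Data.Nat.Combinatorics using (nCk+nC[k+1]≡[n+1]C[k+1]) renaming (_C_ to _choose_)
open import Data.Nat.Induction using (<-rec)
open import Data.Nat.ListAction using (sum)
open import Data.Nat.Properties
open import Data.Product as Product using (Σ; _×_; _,_; proj₁; proj₂; uncurry)
open import Data.Sum using (_⊎_; inj₁; inj₂)
open import Data.Vec using ([]; _∷_; here; there)
import Data.Vec.Properties as Vec
open import Function using (_∘_; id)
open import Function.Bundles using (_⇔_; mk⇔; module Equivalence)
import Function.Properties.Equivalence as ⇔
open import Relation.Binary.Definitions using (tri<; tri≈; tri>)
open import Relation.Binary.PropositionalEquality
open import Relation.Nullary using (¬_; yes; no; contradiction)

open import Defs

private
  variable
    n : ℕ

-- Counting by enumeration

module _ {A B : Set} where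

  Unique-map⁺ : ∀ {f : A → B} {xs} → (∀ {x y} → x ∈ₗ xs → y ∈ₗ xs → f x ≡ f y → x ≡ y) →
                Unique xs → Unique (map f xs)
  Unique-map⁺ {xs = []}     f-inj []            = []
  Unique-map⁺ {xs = x ∷ xs} f-inj (x∉xs ∷ xs!) =
    All.map⁺ (All.tabulate λ y∈ fx≡fy → All.lookup x∉xs y∈ (f-inj (here refl) (there y∈) fx≡fy))
    ∷ Unique-map⁺ (λ x∈ y∈ → f-inj (there x∈) (there y∈)) xs!

  Unique-concatMap⁺ : ∀ {f : A → List B} {xs} (key : B → A) → (∀ {x y} → y ∈ₗ f x → key y ≡ x) →
                      Unique xs → (∀ x → Unique (f x)) → Unique (concatMap f xs)
  Unique-concatMap⁺ {f} key key-∈ xs! f! =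
    Unique.concat⁺ (All.map⁺ (All.tabulate λ {x} _ → f! x)) (AllPairs.map⁺ (AllPairs.map disjoint xs!))
    where
    disjoint : ∀ {x y} → x ≢ y → Disjoint (f x) (f y)
    disjoint x≢y (v∈fx , v∈fy) = x≢y (trans (sym (key-∈ v∈fx)) (key-∈ v∈fy))

  length-concatMap : ∀ (f : A → List B) xs → length (concatMap f xs) ≡ sum (map (length ∘ f) xs)
  length-concatMap f []       = refl
  length-concatMap f (x ∷ xs) = trans (length-++ (f x)) (cong (length (f x) +_) (length-concatMap f xs))

  ∈-concatMap⁺′ : ∀ (f : A → List B) {x xs y} → x ∈ₗ xs → y ∈ₗ f x → y ∈ₗ concatMap f xs
  ∈-concatMap⁺′ f x∈ y∈ = ∈-concatMap⁺ f (lose x∈ y∈)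

  ∈-concatMap⁻′ : ∀ (f : A → List B) {xs y} → y ∈ₗ concatMap f xs → Σ A λ x → x ∈ₗ xs × y ∈ₗ f x
  ∈-concatMap⁻′ f y∈ = find (∈-concatMap⁻ f y∈)

sum-map-const : ∀ {A : Set} (f : A → ℕ) {c} xs → (∀ x → f x ≡ c) → sum (map f xs) ≡ length xs * c
sum-map-const f []       f≡c = refl
sum-map-const f (x ∷ xs) f≡c = cong₂ _+_ (f≡c x) (sum-map-const f xs f≡c)

HasCount-image : ∀ {A : Set} {P : Subset n → Set} (f : A → Subset n) (xs : List A) → Unique xs →
                 (∀ {x y} → x ∈ₗ xs → y ∈ₗ xs → f x ≡ f y → x ≡ y) →
                 (∀ {x} → x ∈ₗ xs → P (f x)) → (∀ {C} → P C → Σ A λ x → x ∈ₗ xs × f x ≡ C) →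
                 HasCount P (length xs)
HasCount-image {P = P} f xs xs! f-inj sound complete =
  map f xs , Unique-map⁺ f-inj xs! , length-map f xs , λ C → mk⇔ (to C) from
  where
  to : ∀ C → C ∈ₗ map f xs → P C
  to C C∈ with ∈-map⁻ f C∈
  ... | x , x∈ , refl = sound x∈
  from : ∀ {C} → P C → C ∈ₗ map f xs
  from PC with complete PC
  ... | x , x∈ , refl = ∈-map⁺ f x∈

HasCount-sized : ∀ {P Q : Subset n → Set} {m m′ q} → m ≡ m′ → (∀ {C} → ∣ C ∣ ≡ m → P C ⇔ Q C) →
                 HasCount (λ C → P C × ∣ C ∣ ≡ m) q → HasCount (λ C → Q C × ∣ C ∣ ≡ m′) q
HasCount-sized {P = P} {Q} {m} refl P⇔Q (xs , xs! , ∣xs∣≡q , ∈⇔P) =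
  xs , xs! , ∣xs∣≡q , λ C → ⇔.trans (∈⇔P C) (sized-⇔ C)
  where
  sized-⇔ : ∀ C → (P C × ∣ C ∣ ≡ m) ⇔ (Q C × ∣ C ∣ ≡ m)
  sized-⇔ C = mk⇔ (λ (p , ∣C∣≡m) → Equivalence.to (P⇔Q ∣C∣≡m) p , ∣C∣≡m)
                  (λ (q , ∣C∣≡m) → Equivalence.from (P⇔Q ∣C∣≡m) q , ∣C∣≡m)

HasCount-none : ∀ {P : Subset n → Set} → (∀ C → ¬ P C) → HasCount P 0
HasCount-none ¬P = [] , [] , refl , λ C → mk⇔ (λ ()) (⊥-elim ∘ ¬P C)

-- Holes and connectivity

-- Membership of a position p : ℕ (positions ≥ n are never members), so that holes can be
-- described by arithmetic on positions.
mem : Subset n → ℕ → Bool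
mem []      p       = false
mem (x ∷ v) zero    = x
mem (x ∷ v) (suc p) = mem v p

x≡true⇒x≢false : ∀ {x : Bool} → x ≡ true → x ≢ false
x≡true⇒x≢false refl ()

∈⇒mem : ∀ {v : Subset n} {i} → i ∈ v → mem v (toℕ i) ≡ true
∈⇒mem here      = refl
∈⇒mem (there p) = ∈⇒mem p

mem⇒∈ : ∀ (v : Subset n) i → mem v (toℕ i) ≡ true → i ∈ v
mem⇒∈ (x ∷ v) Fin.zero    refl = here
mem⇒∈ (x ∷ v) (Fin.suc i) e    = there (mem⇒∈ v i e)

mem⇒< : ∀ (v : Subset n) p → mem v p ≡ true → p < n
mem⇒< (x ∷ v) zero    e = s≤s z≤n
mem⇒< (x ∷ v) (suc p) e = s≤s (mem⇒< v p e)

mem⇒∃∈ : ∀ (v : Subset n) p → mem v p ≡ true → Σ (Fin n) λ i → toℕ i ≡ p × i ∈ v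
mem⇒∃∈ {n} v p e = fromℕ< p<n , toℕ-fromℕ< p<n , mem⇒∈ v _ (trans (cong (mem v) (toℕ-fromℕ< p<n)) e)
  where
  p<n : p < n
  p<n = mem⇒< v p e

data DoubleHole (v : Subset n) : Set where
  doubleHole : ∀ a b c → mem v a ≡ true → mem v c ≡ true → a < b → suc b < c →
               mem v b ≡ false → mem v (suc b) ≡ false → DoubleHole v

data Hole (v : Subset n) : Set where
  hole : ∀ a b c → mem v a ≡ true → mem v c ≡ true → a < b → b < c →
         mem v b ≡ false → Hole v

SqPathAdj-sym : ∀ {i j : Fin n} → SqPathAdj i j → SqPathAdj j i
SqPathAdj-sym (inj₁ e)               = inj₂ (inj₂ (inj₁ e))
SqPathAdj-sym (inj₂ (inj₁ e))        = inj₂ (inj₂ (inj₂ e))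
SqPathAdj-sym (inj₂ (inj₂ (inj₁ e))) = inj₁ e
SqPathAdj-sym (inj₂ (inj₂ (inj₂ e))) = inj₂ (inj₁ e)

module _ {S : Subset n} where

  Reach-prepend : ∀ {u x w} → SqPathAdj u x → u ∈ S → Reach SqPathAdj S x w → Reach SqPathAdj S u w
  Reach-prepend ux u∈ (here x∈)       = step (here u∈) ux x∈
  Reach-prepend ux u∈ (step r vw w∈) = step (Reach-prepend ux u∈ r) vw w∈

  Reach-sym : ∀ {u w} → Reach SqPathAdj S u w → Reach SqPathAdj S w u
  Reach-sym (here u∈)       = here u∈
  Reach-sym (step r vw w∈) = Reach-prepend (SqPathAdj-sym vw) w∈ (Reach-sym r)

  member≤1+b⇒<b : ∀ {b p} → mem S b ≡ false → mem S (suc b) ≡ false →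
                  mem S p ≡ true → p ≤ suc b → p < b
  member≤1+b⇒<b {b} {p} b∉ b+1∉ p∈ p≤1+b with <-cmp p b
  ... | tri< p<b _ _ = p<b
  ... | tri≈ _ refl _ = contradiction b∉ (x≡true⇒x≢false p∈)
  ... | tri> _ _ b<p with ≤-antisym p≤1+b b<p
  ...   | refl = contradiction b+1∉ (x≡true⇒x≢false p∈)

  Reach-below : ∀ {u w} b → mem S b ≡ false → mem S (suc b) ≡ false →
                toℕ u < b → Reach SqPathAdj S u w → toℕ w < b
  Reach-below b b∉ b+1∉ u<b (here _) = u<b
  Reach-below b b∉ b+1∉ u<b (step {v} {w} r vw w∈) with Reach-below b b∉ b+1∉ u<b r | vw
  ... | v<b | inj₁ e               = member≤1+b⇒<b b∉ b+1∉ (∈⇒mem w∈)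
                                       (≤-trans (≤-reflexive (trans e (+-comm (toℕ v) 1))) (m≤n⇒m≤1+n v<b))
  ... | v<b | inj₂ (inj₁ e)        = member≤1+b⇒<b b∉ b+1∉ (∈⇒mem w∈)
                                       (≤-trans (≤-reflexive (trans e (+-comm (toℕ v) 2))) (s≤s v<b))
  ... | v<b | inj₂ (inj₂ (inj₁ e)) = <-trans (subst (toℕ w <_) (sym e) (m<m+n (toℕ w) z<s)) v<b
  ... | v<b | inj₂ (inj₂ (inj₂ e)) = <-trans (subst (toℕ w <_) (sym e) (m<m+n (toℕ w) z<s)) v<b

  connected⇒¬DoubleHole : InducedConnected SqPathAdj S → ¬ DoubleHole S
  connected⇒¬DoubleHole conn (doubleHole a b c a∈ c∈ a<b b+1<c b∉ b+1∉)
    with mem⇒∃∈ S a a∈ | mem⇒∃∈ S c c∈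
  ... | i , refl , i∈ | j , refl , j∈ =
    <-asym (Reach-below b b∉ b+1∉ a<b (conn i j i∈ j∈)) (<-trans (n<1+n b) b+1<c)

  previous-member : ¬ DoubleHole S → ∀ {a c} → mem S a ≡ true → mem S c ≡ true → a < c →
                    Σ ℕ λ b → a ≤ b × mem S b ≡ true × (c ≡ b + 1 ⊎ c ≡ b + 2)
  previous-member ¬dh {a} {suc c} a∈ c+1∈ (s≤s a≤c) with mem S c in c∈
  ... | true = c , a≤c , c∈ , inj₁ (+-comm 1 c)
  ... | false with m≤n⇒m<n∨m≡n a≤c
  ...   | inj₂ refl = contradiction c∈ (x≡true⇒x≢false a∈)
  ...   | inj₁ (s≤s {n = b} a≤b) with mem S b in b∈
  ...     | true = b , a≤b , b∈ , inj₂ (+-comm 2 b)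
  ...     | false with m≤n⇒m<n∨m≡n a≤b
  ...       | inj₂ refl = contradiction b∈ (x≡true⇒x≢false a∈)
  ...       | inj₁ a<b = ⊥-elim (¬dh (doubleHole a b (suc c) a∈ c+1∈ a<b ≤-refl b∈ c∈))

  ¬DoubleHole⇒reach-upward : ¬ DoubleHole S → ∀ {u w} → u ∈ S → w ∈ S → toℕ u ≤ toℕ w →
                             Reach SqPathAdj S u w
  ¬DoubleHole⇒reach-upward ¬dh {u} {w} u∈ w∈ u≤w = <-rec P go (toℕ w) w refl w∈ u≤w
    where
    P : ℕ → Set
    P c = ∀ w → toℕ w ≡ c → w ∈ S → toℕ u ≤ c → Reach SqPathAdj S u w
    go : ∀ c → (∀ {b} → b < c → P b) → P c
    go c rec w refl w∈ u≤w with m≤n⇒m<n∨m≡n u≤w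
    ... | inj₂ u≡w rewrite toℕ-injective u≡w = here w∈
    ... | inj₁ u<w with previous-member ¬dh (∈⇒mem u∈) (∈⇒mem w∈) u<w
    ...   | b , u≤b , b∈ , w≡b+d with mem⇒∃∈ S b b∈
    ...     | x , refl , x∈ with w≡b+d
    ...       | inj₁ e = step (rec (subst (toℕ x <_) (sym e) (m<m+n _ z<s)) x refl x∈ u≤b) (inj₁ e) w∈
    ...       | inj₂ e = step (rec (subst (toℕ x <_) (sym e) (m<m+n _ z<s)) x refl x∈ u≤b) (inj₂ (inj₁ e)) w∈

  ¬DoubleHole⇒connected : ¬ DoubleHole S → InducedConnected SqPathAdj S
  ¬DoubleHole⇒connected ¬dh u w u∈ w∈ with ≤-total (toℕ u) (toℕ w)
  ... | inj₁ u≤w = ¬DoubleHole⇒reach-upward ¬dh u∈ w∈ u≤w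
  ... | inj₂ w≤u = Reach-sym (¬DoubleHole⇒reach-upward ¬dh w∈ u∈ w≤u)

¬DoubleHole⇒adjacent-member : ∀ {S : Subset n} → ¬ DoubleHole S → ∀ {a b c} →
  mem S a ≡ true → mem S c ≡ true → a ≤ b → suc b ≤ c → mem S b ≡ true ⊎ mem S (suc b) ≡ true
¬DoubleHole⇒adjacent-member {S = S} ¬dh {a} {b} {c} a∈ c∈ a≤b b<c with mem S b in b∈ | mem S (suc b) in b+1∈
... | true  | _     = inj₁ refl
... | false | true  = inj₂ refl
... | false | false = ⊥-elim (¬dh (doubleHole a b c a∈ c∈ a<b (≤∧≢⇒< b<c b+1≢c) b∈ b+1∈))
  where
  a<b : a < b
  a<b = ≤∧≢⇒< a≤b λ { refl → x≡true⇒x≢false a∈ b∈ }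
  b+1≢c : suc b ≢ c
  b+1≢c refl = x≡true⇒x≢false c∈ b+1∈

¬Hole⇒between-member : ∀ {C : Subset n} → ¬ Hole C → ∀ {a b c} →
                       mem C a ≡ true → mem C c ≡ true → a < b → b < c → mem C b ≡ true
¬Hole⇒between-member {C = C} ¬h {a} {b} {c} a∈ c∈ a<b b<c with mem C b in b∈
... | true  = refl
... | false = ⊥-elim (¬h (hole a b c a∈ c∈ a<b b<c b∈))

-- Deleting a position

remove : Subset n → ℕ → Subset n
remove []      e       = []
remove (x ∷ v) zero    = false ∷ v
remove (x ∷ v) (suc e) = x ∷ remove v e

mem-remove-≢ : ∀ (v : Subset n) {e p} → p ≢ e → mem (remove v e) p ≡ mem v p
mem-remove-≢ []      {e}     {p}     p≢e = refl
mem-remove-≢ (x ∷ v) {zero}  {zero}  p≢e = contradiction refl p≢e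
mem-remove-≢ (x ∷ v) {zero}  {suc p} p≢e = refl
mem-remove-≢ (x ∷ v) {suc e} {zero}  p≢e = refl
mem-remove-≢ (x ∷ v) {suc e} {suc p} p≢e = mem-remove-≢ v (p≢e ∘ cong suc)

mem-remove-self : ∀ (v : Subset n) e → mem (remove v e) e ≡ false
mem-remove-self []      e       = refl
mem-remove-self (x ∷ v) zero    = refl
mem-remove-self (x ∷ v) (suc e) = mem-remove-self v e

mem-remove⇒≢ : ∀ (v : Subset n) {e p} → mem (remove v e) p ≡ true → p ≢ e
mem-remove⇒≢ v {e} p∈ refl = x≡true⇒x≢false p∈ (mem-remove-self v e)

mem-remove⇒mem : ∀ (v : Subset n) {e p} → mem (remove v e) p ≡ true → mem v p ≡ true
mem-remove⇒mem v p∈ = trans (sym (mem-remove-≢ v (mem-remove⇒≢ v p∈))) p∈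

mem-remove-true : ∀ (v : Subset n) {e p} → p ≢ e → mem v p ≡ true → mem (remove v e) p ≡ true
mem-remove-true v p≢e p∈ = trans (mem-remove-≢ v p≢e) p∈

mem-remove-false : ∀ (v : Subset n) {e p} → mem v p ≡ false → mem (remove v e) p ≡ false
mem-remove-false v {e} {p} p∉ with p ≟ e
... | yes refl = mem-remove-self v e
... | no p≢e   = trans (mem-remove-≢ v p≢e) p∉

∣remove∣ : ∀ (v : Subset n) {e} → mem v e ≡ true → suc ∣ remove v e ∣ ≡ ∣ v ∣
∣remove∣ (true ∷ v)  {zero}  refl = refl
∣remove∣ (true ∷ v)  {suc e} e∈   = cong suc (∣remove∣ v e∈)
∣remove∣ (false ∷ v) {suc e} e∈   = ∣remove∣ v e∈

∣remove∣≥ : ∀ (v : Subset n) e → ∣ v ∣ ≤ suc ∣ remove v e ∣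
∣remove∣≥ []          e       = z≤n
∣remove∣≥ (true ∷ v)  zero    = ≤-refl
∣remove∣≥ (false ∷ v) zero    = n≤1+n _
∣remove∣≥ (true ∷ v)  (suc e) = s≤s (∣remove∣≥ v e)
∣remove∣≥ (false ∷ v) (suc e) = ∣remove∣≥ v e

⊆⇒mem : ∀ {D C : Subset n} → D ⊆ C → ∀ {p} → mem D p ≡ true → mem C p ≡ true
⊆⇒mem {D = D} D⊆C {p} p∈ with mem⇒∃∈ D p p∈
... | i , refl , i∈ = ∈⇒mem (D⊆C i∈)

mem⇒⊆ : ∀ {D C : Subset n} → (∀ {p} → mem D p ≡ true → mem C p ≡ true) → D ⊆ C
mem⇒⊆ {C = C} D⇒C {i} i∈ = mem⇒∈ C i (D⇒C (∈⇒mem i∈))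

remove⊆ : ∀ (v : Subset n) e → remove v e ⊆ v
remove⊆ v e = mem⇒⊆ (mem-remove⇒mem v)

⊆-remove : ∀ {D C : Subset n} {e} → D ⊆ C → mem D e ≡ false → D ⊆ remove C e
⊆-remove {C = C} D⊆C e∉D = mem⇒⊆ λ p∈ →
  trans (mem-remove-≢ C λ { refl → x≡true⇒x≢false p∈ e∉D }) (⊆⇒mem D⊆C p∈)

⊆∧∣≡∣⇒≡ : ∀ {D C : Subset n} → D ⊆ C → ∣ D ∣ ≡ ∣ C ∣ → D ≡ C
⊆∧∣≡∣⇒≡ {D = []}        {[]}        _   _ = refl
⊆∧∣≡∣⇒≡ {D = true ∷ D}  {true ∷ C}  D⊆C e = cong (true ∷_) (⊆∧∣≡∣⇒≡ (drop-∷-⊆ D⊆C) (suc-injective e))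
⊆∧∣≡∣⇒≡ {D = true ∷ D}  {false ∷ C} D⊆C e with () ← D⊆C here
⊆∧∣≡∣⇒≡ {D = false ∷ D} {true ∷ C}  D⊆C e = contradiction e (<⇒≢ (s≤s (p⊆q⇒∣p∣≤∣q∣ (drop-∷-⊆ D⊆C))))
⊆∧∣≡∣⇒≡ {D = false ∷ D} {false ∷ C} D⊆C e = cong (false ∷_) (⊆∧∣≡∣⇒≡ (drop-∷-⊆ D⊆C) e)

⊆-of-size : ∀ (C : Subset n) {m} → m ≤ ∣ C ∣ → Σ (Subset n) λ D → D ⊆ C × ∣ D ∣ ≡ m
⊆-of-size {n} C       {zero}  _  = ⊥ , ⊥⊆ , ∣⊥∣≡0 n
⊆-of-size (false ∷ C) {suc m} le with ⊆-of-size C le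
... | D , D⊆C , ∣D∣≡m = false ∷ D , s⊆s D⊆C , ∣D∣≡m
⊆-of-size (true ∷ C)  {suc m} (s≤s le) with ⊆-of-size C le
... | D , D⊆C , ∣D∣≡m = true ∷ D , s⊆s D⊆C , cong suc ∣D∣≡m

nonempty⇒member : ∀ (v : Subset n) → 1 ≤ ∣ v ∣ → Σ ℕ λ p → mem v p ≡ true
nonempty⇒member (true ∷ v)  _  = 0 , refl
nonempty⇒member (false ∷ v) le with nonempty⇒member v le
... | p , p∈ = suc p , p∈

member-avoiding : ∀ (C : Subset n) → 3 ≤ ∣ C ∣ → ∀ x y → Σ ℕ λ e → mem C e ≡ true × e ≢ x × e ≢ y
member-avoiding C 3≤∣C∣ x y
  with nonempty⇒member (remove (remove C x) y)
         (≤-pred (≤-pred (≤-trans 3≤∣C∣ (≤-trans (∣remove∣≥ C x) (s≤s (∣remove∣≥ (remove C x) y))))))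
... | e , e∈ = e , mem-remove⇒mem C (mem-remove⇒mem (remove C x) e∈) ,
               mem-remove⇒≢ C (mem-remove⇒mem (remove C x) e∈) , mem-remove⇒≢ (remove C x) e∈

-- k-bad sets

KBad-⊆ : ∀ {G : Graph n} {k C D} → KBad G k C → D ⊆ C → k ≤ ∣ D ∣ → KBad G k D
KBad-⊆ (_ , C-bad) D⊆C k≤∣D∣ = k≤∣D∣ , λ E E⊆D ∣E∣≡k → C-bad E (D⊆C ∘ E⊆D) ∣E∣≡k

module _ {k} {C : Subset n} (C-bad : KBad SqPathAdj k C) (∣C∣≡1+k : ∣ C ∣ ≡ suc k) (2≤k : 2 ≤ k) where

  private
    ¬DoubleHole-remove : ∀ {e} → mem C e ≡ true → ¬ DoubleHole (remove C e)
    ¬DoubleHole-remove e∈ = connected⇒¬DoubleHole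
      (proj₂ C-bad _ (remove⊆ C _) (suc-injective (trans (∣remove∣ C e∈) ∣C∣≡1+k)))

    3≤∣C∣ : 3 ≤ ∣ C ∣
    3≤∣C∣ = subst (3 ≤_) (sym ∣C∣≡1+k) (s≤s 2≤k)

  KBad-suc⇒¬DoubleHole : ¬ DoubleHole C
  KBad-suc⇒¬DoubleHole (doubleHole a b c a∈ c∈ a<b b+1<c b∉ b+1∉) with member-avoiding C 3≤∣C∣ a c
  ... | e , e∈ , e≢a , e≢c = ¬DoubleHole-remove e∈
    (doubleHole a b c (mem-remove-true C (e≢a ∘ sym) a∈) (mem-remove-true C (e≢c ∘ sym) c∈) a<b b+1<c
                (mem-remove-false C b∉) (mem-remove-false C b+1∉))

  neighbours∈⇒member : ∀ {b} → mem C b ≡ true → mem C (suc (suc b)) ≡ true → mem C (suc b) ≡ true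
  neighbours∈⇒member {b} b∈ b+2∈ with mem C (suc b) in b+1∈
  ... | true  = refl
  ... | false with member-avoiding C 3≤∣C∣ b (suc (suc b))
  ...   | e , e∈ , e≢b , e≢b+2 with <-cmp e (suc b)
  ...     | tri≈ _ refl _ = contradiction b+1∈ (x≡true⇒x≢false e∈)
  ...     | tri< e<b+1 _ _ = ⊥-elim (¬DoubleHole-remove b∈
    (doubleHole e b (suc (suc b)) (mem-remove-true C e≢b e∈) (mem-remove-true C (>⇒≢ (m<n+m b {2} z<s)) b+2∈)
                (≤∧≢⇒< (≤-pred e<b+1) e≢b) ≤-refl (mem-remove-self C b) (mem-remove-false C b+1∈)))
  ...     | tri> _ _ b+1<e = ⊥-elim (¬DoubleHole-remove b+2∈
    (doubleHole b (suc b) e (mem-remove-true C (<⇒≢ (m<n+m b {2} z<s)) b∈) (mem-remove-true C e≢b+2 e∈)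
                ≤-refl (≤∧≢⇒< b+1<e (e≢b+2 ∘ sym)) (mem-remove-false C b+1∈) (mem-remove-self C (suc (suc b)))))

  KBad-suc⇒¬Hole : ¬ Hole C
  KBad-suc⇒¬Hole (hole a zero c _ _ () _ _)
  KBad-suc⇒¬Hole (hole a (suc b) c a∈ c∈ a<b+1 b+1<c b+1∉) =
    x≡true⇒x≢false (neighbours∈⇒member b∈ b+2∈) b+1∉
    where
    b∈ : mem C b ≡ true
    b∈ with ¬DoubleHole⇒adjacent-member KBad-suc⇒¬DoubleHole a∈ c∈ (≤-pred a<b+1) (<-trans (n<1+n b) b+1<c)
    ... | inj₁ b∈   = b∈
    ... | inj₂ b+1∈ = contradiction b+1∉ (x≡true⇒x≢false b+1∈)
    b+2∈ : mem C (suc (suc b)) ≡ true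
    b+2∈ with ¬DoubleHole⇒adjacent-member KBad-suc⇒¬DoubleHole a∈ c∈ (<⇒≤ a<b+1) b+1<c
    ... | inj₁ b+1∈ = contradiction b+1∉ (x≡true⇒x≢false b+1∈)
    ... | inj₂ b+2∈ = b+2∈

hole-at-removed : ∀ (C : Subset n) {a b c} → mem C a ≡ true → mem C c ≡ true → a < b → b < c →
                  Hole (remove C b)
hole-at-removed C a∈ c∈ a<b b<c =
  hole _ _ _ (mem-remove-true C (<⇒≢ a<b) a∈) (mem-remove-true C (>⇒≢ b<c) c∈) a<b b<c (mem-remove-self C _)

median-member : ∀ (C : Subset n) {x y z} → mem C x ≡ true → mem C y ≡ true → mem C z ≡ true →
                x < y → z ≢ x → z ≢ y → Σ ℕ λ b → mem C b ≡ true × Hole (remove C b)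
median-member C {x} {y} {z} x∈ y∈ z∈ x<y z≢x z≢y with <-cmp z x | <-cmp z y
... | tri< z<x _ _ | _              = _ , x∈ , hole-at-removed C z∈ y∈ z<x x<y
... | tri≈ _ z≡x _ | _              = contradiction z≡x z≢x
... | tri> _ _ x<z | tri< z<y _ _   = _ , z∈ , hole-at-removed C x∈ y∈ x<z z<y
... | tri> _ _ _   | tri≈ _ z≡y _   = contradiction z≡y z≢y
... | tri> _ _ _   | tri> _ _ y<z   = _ , y∈ , hole-at-removed C x∈ z∈ x<y y<z

middle-member : ∀ (C : Subset n) → 3 ≤ ∣ C ∣ → Σ ℕ λ b → mem C b ≡ true × Hole (remove C b)
middle-member C 3≤∣C∣ with nonempty⇒member C (≤-trans (s≤s z≤n) 3≤∣C∣)
... | x , x∈ with member-avoiding C 3≤∣C∣ x x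
... | y , y∈ , y≢x , _ with member-avoiding C 3≤∣C∣ x y
... | z , z∈ , z≢x , z≢y with <-cmp x y
...   | tri< x<y _ _ = median-member C x∈ y∈ z∈ x<y z≢x z≢y
...   | tri≈ _ x≡y _ = contradiction (sym x≡y) y≢x
...   | tri> _ _ y<x = median-member C y∈ x∈ z∈ y<x z≢y z≢x

¬KBad-large : ∀ {k} {C : Subset n} → 2 ≤ k → k + 2 ≤ ∣ C ∣ → ¬ KBad SqPathAdj k C
¬KBad-large {k = k} {C} 2≤k k+2≤∣C∣ C-bad with ⊆-of-size C (subst (_≤ ∣ C ∣) (+-comm k 2) k+2≤∣C∣)
... | D , D⊆C , ∣D∣≡2+k with middle-member D (subst (3 ≤_) (sym ∣D∣≡2+k) (s≤s (s≤s (≤-trans (n≤1+n 1) 2≤k))))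
... | b , b∈ , D-b-hole =
  KBad-suc⇒¬Hole (KBad-⊆ C-bad (D⊆C ∘ remove⊆ D b) (subst (k ≤_) (sym ∣D-b∣≡1+k) (n≤1+n k))) ∣D-b∣≡1+k 2≤k D-b-hole
  where
  ∣D-b∣≡1+k : ∣ remove D b ∣ ≡ suc k
  ∣D-b∣≡1+k = suc-injective (trans (∣remove∣ D b∈) ∣D∣≡2+k)

2+∣D∣≤∣C∣ : ∀ {D C : Subset n} {b} → D ⊆ C → mem C b ≡ true → mem C (suc b) ≡ true →
            mem D b ≡ false → mem D (suc b) ≡ false → 2 + ∣ D ∣ ≤ ∣ C ∣
2+∣D∣≤∣C∣ {D = D} {C} {b} D⊆C b∈C b+1∈C b∉D b+1∉D = begin
  2 + ∣ D ∣
    ≤⟨ s≤s (s≤s (p⊆q⇒∣p∣≤∣q∣ (⊆-remove (⊆-remove D⊆C b∉D) b+1∉D))) ⟩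
  2 + ∣ remove (remove C b) (suc b) ∣
    ≡⟨ cong suc (∣remove∣ (remove C b) (mem-remove-true C (>⇒≢ (n<1+n b)) b+1∈C)) ⟩
  suc ∣ remove C b ∣
    ≡⟨ ∣remove∣ C b∈C ⟩
  ∣ C ∣ ∎
  where open ≤-Reasoning

¬Hole⇒KBad-suc : ∀ {k} {C : Subset n} → ∣ C ∣ ≡ suc k → ¬ Hole C → KBad SqPathAdj k C
¬Hole⇒KBad-suc {k = k} {C} ∣C∣≡1+k ¬h = subst (k ≤_) (sym ∣C∣≡1+k) (n≤1+n k) , k-subsets-connected
  where
  k-subsets-connected : ∀ D → D ⊆ C → ∣ D ∣ ≡ k → InducedConnected SqPathAdj D
  k-subsets-connected D D⊆C ∣D∣≡k = ¬DoubleHole⇒connected λ where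
    (doubleHole a b c a∈ c∈ a<b b+1<c b∉ b+1∉) →
      let a∈C = ⊆⇒mem D⊆C a∈
          c∈C = ⊆⇒mem D⊆C c∈
          b∈C = ¬Hole⇒between-member ¬h a∈C c∈C a<b (<-trans (n<1+n b) b+1<c)
          b+1∈C = ¬Hole⇒between-member ¬h a∈C c∈C (<-trans a<b (n<1+n b)) b+1<c
      in 1+n≰n (subst₂ (λ d c → 2 + d ≤ c) ∣D∣≡k ∣C∣≡1+k (2+∣D∣≤∣C∣ D⊆C b∈C b+1∈C b∉ b+1∉))

connected⇔KBad-of-size : ∀ {G : Graph n} {k C} → ∣ C ∣ ≡ k → InducedConnected G C ⇔ KBad G k C
connected⇔KBad-of-size {G = G} {k} {C} ∣C∣≡k = mk⇔ connected⇒KBad (λ (_ , C-bad) → C-bad C id ∣C∣≡k)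
  where
  connected⇒KBad : InducedConnected G C → KBad G k C
  connected⇒KBad conn = ≤-reflexive (sym ∣C∣≡k) , λ D D⊆C ∣D∣≡k →
    subst (InducedConnected G) (sym (⊆∧∣≡∣⇒≡ D⊆C (trans ∣D∣≡k (sym ∣C∣≡k)))) conn

¬Hole⇔KBad-of-size-suc : ∀ {k} {C : Subset n} → 2 ≤ k → ∣ C ∣ ≡ suc k → (¬ Hole C) ⇔ KBad SqPathAdj k C
¬Hole⇔KBad-of-size-suc 2≤k ∣C∣≡1+k = mk⇔ (¬Hole⇒KBad-suc ∣C∣≡1+k) (λ C-bad → KBad-suc⇒¬Hole C-bad ∣C∣≡1+k 2≤k)

-- Walks

-- walk n s w consists of s and the positions reached from it by the steps of w, cut off at n;
-- landings n w are the positions reached from −1.  Fits n s w says that nothing is cut off.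
data Step : Set where
  one two : Step

span : List Step → ℕ
span []        = 0
span (one ∷ w) = 1 + span w
span (two ∷ w) = 2 + span w

landings : ∀ n → List Step → Subset n
landings zero          w         = []
landings (suc n)       []        = ⊥
landings (suc n)       (one ∷ w) = true ∷ landings n w
landings (suc zero)    (two ∷ w) = false ∷ []
landings (suc (suc n)) (two ∷ w) = false ∷ true ∷ landings n w

walk : ∀ n → ℕ → List Step → Subset n
walk zero    s       w = []
walk (suc n) zero    w = true ∷ landings n w
walk (suc n) (suc s) w = false ∷ walk n s w

Fits : ℕ → ℕ → List Step → Set
Fits n s w = s + suc (span w) ≤ n

ones : ℕ → List Step
ones k = replicate k one

twos : List Step → ℕ
twos []        = 0
twos (one ∷ w) = twos w
twos (two ∷ w) = suc (twos w)

span≡length+twos : ∀ w → span w ≡ length w + twos w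
span≡length+twos []        = refl
span≡length+twos (one ∷ w) = cong suc (span≡length+twos w)
span≡length+twos (two ∷ w) = cong suc (trans (cong suc (span≡length+twos w)) (sym (+-suc (length w) (twos w))))

twos≤length : ∀ w → twos w ≤ length w
twos≤length []        = z≤n
twos≤length (one ∷ w) = m≤n⇒m≤1+n (twos≤length w)
twos≤length (two ∷ w) = s≤s (twos≤length w)

span-ones : ∀ k → span (ones k) ≡ k
span-ones zero    = refl
span-ones (suc k) = cong suc (span-ones k)

mem-⊥ : ∀ n p → mem (⊥ {n}) p ≡ false
mem-⊥ zero    p       = refl
mem-⊥ (suc n) zero    = refl
mem-⊥ (suc n) (suc p) = mem-⊥ n p

⊥-or-member : ∀ (v : Subset n) → v ≡ ⊥ ⊎ Σ ℕ λ p → mem v p ≡ true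
⊥-or-member []          = inj₁ refl
⊥-or-member (true ∷ v)  = inj₂ (0 , refl)
⊥-or-member (false ∷ v) with ⊥-or-member v
... | inj₁ refl       = inj₁ refl
... | inj₂ (p , p∈)   = inj₂ (suc p , p∈)

module _ {x : Bool} {v : Subset n} where

  DoubleHole-∷ : DoubleHole v → DoubleHole (x ∷ v)
  DoubleHole-∷ (doubleHole a b c a∈ c∈ a<b b+1<c b∉ b+1∉) =
    doubleHole (suc a) (suc b) (suc c) a∈ c∈ (s≤s a<b) (s≤s b+1<c) b∉ b+1∉

  Hole-∷ : Hole v → Hole (x ∷ v)
  Hole-∷ (hole a b c a∈ c∈ a<b b<c b∉) = hole (suc a) (suc b) (suc c) a∈ c∈ (s≤s a<b) (s≤s b<c) b∉

module _ {v : Subset n} where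

  DoubleHole-false∷⁻ : DoubleHole (false ∷ v) → DoubleHole v
  DoubleHole-false∷⁻ (doubleHole (suc a) (suc b) (suc c) a∈ c∈ a<b b+1<c b∉ b+1∉) =
    doubleHole a b c a∈ c∈ (≤-pred a<b) (≤-pred b+1<c) b∉ b+1∉

  DoubleHole-true∷true∷⁻ : DoubleHole (true ∷ true ∷ v) → DoubleHole (true ∷ v)
  DoubleHole-true∷true∷⁻ (doubleHole zero (suc (suc b)) (suc c) _ c∈ _ b+1<c b∉ b+1∉) =
    doubleHole zero (suc b) c refl c∈ z<s (≤-pred b+1<c) b∉ b+1∉
  DoubleHole-true∷true∷⁻ (doubleHole (suc a) (suc b) (suc c) a∈ c∈ a<b b+1<c b∉ b+1∉) =
    doubleHole a b c a∈ c∈ (≤-pred a<b) (≤-pred b+1<c) b∉ b+1∉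

  DoubleHole-true∷false∷true∷⁻ : DoubleHole (true ∷ false ∷ true ∷ v) → DoubleHole (true ∷ v)
  DoubleHole-true∷false∷true∷⁻ (doubleHole zero (suc (suc (suc b))) (suc (suc c)) _ c∈ _ b+1<c b∉ b+1∉) =
    doubleHole zero (suc b) c refl c∈ z<s (≤-pred (≤-pred b+1<c)) b∉ b+1∉
  DoubleHole-true∷false∷true∷⁻ (doubleHole (suc (suc a)) (suc (suc b)) (suc (suc c)) a∈ c∈ a<b b+1<c b∉ b+1∉) =
    doubleHole a b c a∈ c∈ (≤-pred (≤-pred a<b)) (≤-pred (≤-pred b+1<c)) b∉ b+1∉

  Hole-false∷⁻ : Hole (false ∷ v) → Hole v
  Hole-false∷⁻ (hole (suc a) (suc b) (suc c) a∈ c∈ a<b b<c b∉) = hole a b c a∈ c∈ (≤-pred a<b) (≤-pred b<c) b∉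

  Hole-true∷true∷⁻ : Hole (true ∷ true ∷ v) → Hole (true ∷ v)
  Hole-true∷true∷⁻ (hole zero (suc (suc b)) (suc c) _ c∈ _ b<c b∉) =
    hole zero (suc b) c refl c∈ z<s (≤-pred b<c) b∉
  Hole-true∷true∷⁻ (hole (suc a) (suc b) (suc c) a∈ c∈ a<b b<c b∉) =
    hole a b c a∈ c∈ (≤-pred a<b) (≤-pred b<c) b∉

¬DoubleHole-true∷⊥ : ∀ n → ¬ DoubleHole (true ∷ ⊥ {n})
¬DoubleHole-true∷⊥ n (doubleHole a b (suc c) a∈ c∈ a<b b+1<c b∉ b+1∉) = x≡true⇒x≢false c∈ (mem-⊥ n c)

¬Hole-true∷⊥ : ∀ n → ¬ Hole (true ∷ ⊥ {n})
¬Hole-true∷⊥ n (hole a b (suc c) a∈ c∈ a<b b<c b∉) = x≡true⇒x≢false c∈ (mem-⊥ n c)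

¬DoubleHole-true∷landings : ∀ n w → ¬ DoubleHole (true ∷ landings n w)
¬DoubleHole-true∷landings zero          w         = ¬DoubleHole-true∷⊥ zero
¬DoubleHole-true∷landings (suc n)       []        = ¬DoubleHole-true∷⊥ (suc n)
¬DoubleHole-true∷landings (suc n)       (one ∷ w) = ¬DoubleHole-true∷landings n w ∘ DoubleHole-true∷true∷⁻
¬DoubleHole-true∷landings (suc zero)    (two ∷ w) = ¬DoubleHole-true∷⊥ 1
¬DoubleHole-true∷landings (suc (suc n)) (two ∷ w) = ¬DoubleHole-true∷landings n w ∘ DoubleHole-true∷false∷true∷⁻

¬DoubleHole-walk : ∀ n s w → ¬ DoubleHole (walk n s w)
¬DoubleHole-walk zero    s       w (doubleHole a b c () _ _ _ _ _)
¬DoubleHole-walk (suc n) zero    w = ¬DoubleHole-true∷landings n w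
¬DoubleHole-walk (suc n) (suc s) w = ¬DoubleHole-walk n s w ∘ DoubleHole-false∷⁻

¬Hole-true∷landings-ones : ∀ n k → ¬ Hole (true ∷ landings n (ones k))
¬Hole-true∷landings-ones zero    k       = ¬Hole-true∷⊥ zero
¬Hole-true∷landings-ones (suc n) zero    = ¬Hole-true∷⊥ (suc n)
¬Hole-true∷landings-ones (suc n) (suc k) = ¬Hole-true∷landings-ones n k ∘ Hole-true∷true∷⁻

¬Hole-walk-ones : ∀ n s k → ¬ Hole (walk n s (ones k))
¬Hole-walk-ones zero    s       k (hole a b c () _ _ _ _)
¬Hole-walk-ones (suc n) zero    k = ¬Hole-true∷landings-ones n k
¬Hole-walk-ones (suc n) (suc s) k = ¬Hole-walk-ones n s k ∘ Hole-false∷⁻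

∣landings∣ : ∀ n w → span w ≤ n → ∣ landings n w ∣ ≡ length w
∣landings∣ zero          []        _                = refl
∣landings∣ zero          (one ∷ w) ()
∣landings∣ zero          (two ∷ w) ()
∣landings∣ (suc n)       []        _                = ∣⊥∣≡0 (suc n)
∣landings∣ (suc n)       (one ∷ w) (s≤s span≤n)     = cong suc (∣landings∣ n w span≤n)
∣landings∣ (suc (suc n)) (two ∷ w) (s≤s (s≤s span≤n)) = cong suc (∣landings∣ n w span≤n)

∣walk∣ : ∀ n s w → Fits n s w → ∣ walk n s w ∣ ≡ suc (length w)
∣walk∣ (suc n) zero    w (s≤s fits) = cong suc (∣landings∣ n w fits)
∣walk∣ (suc n) (suc s) w (s≤s fits) = ∣walk∣ n s w fits

landings-injective : ∀ n {w w′} → span w ≤ n → span w′ ≤ n → landings n w ≡ landings n w′ → w ≡ w′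
landings-injective _ {[]} {[]} _ _ _ = refl
landings-injective (suc n) {one ∷ w} {one ∷ w′} (s≤s ≤n) (s≤s ≤n′) e =
  cong (one ∷_) (landings-injective n ≤n ≤n′ (Vec.∷-injectiveʳ e))
landings-injective (suc (suc n)) {two ∷ w} {two ∷ w′} (s≤s (s≤s ≤n)) (s≤s (s≤s ≤n′)) e =
  cong (two ∷_) (landings-injective n ≤n ≤n′ (Vec.∷-injectiveʳ (Vec.∷-injectiveʳ e)))
landings-injective (suc n)       {[]}      {one ∷ _} _ _ ()
landings-injective (suc (suc n)) {[]}      {two ∷ _} _ _ ()
landings-injective (suc zero)    {[]}      {two ∷ _} _ (s≤s ()) _
landings-injective (suc zero)    {two ∷ _} {[]}      (s≤s ()) _ _
landings-injective (suc n)       {one ∷ _} {[]}      _ _ ()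
landings-injective (suc (suc n)) {one ∷ _} {two ∷ _} _ _ ()
landings-injective (suc (suc n)) {two ∷ _} {[]}      _ _ ()
landings-injective (suc (suc n)) {two ∷ _} {one ∷ _} _ _ ()

walk-injective : ∀ n {s s′ w w′} → Fits n s w → Fits n s′ w′ → walk n s w ≡ walk n s′ w′ → s ≡ s′ × w ≡ w′
walk-injective (suc n) {zero}  {zero}   (s≤s fits) (s≤s fits′) e =
  refl , landings-injective n fits fits′ (Vec.∷-injectiveʳ e)
walk-injective (suc n) {suc s} {suc s′} (s≤s fits) (s≤s fits′) e
  with walk-injective n fits fits′ (Vec.∷-injectiveʳ e)
... | refl , refl = refl , refl

¬DoubleHole⇒landings : ∀ n (v : Subset n) → ¬ DoubleHole (true ∷ v) →
                       Σ (List Step) λ w → v ≡ landings n w × span w ≤ n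
¬DoubleHole⇒landings zero          []                 _   = [] , refl , z≤n
¬DoubleHole⇒landings (suc n)       (true ∷ v)         ¬dh with ¬DoubleHole⇒landings n v (¬dh ∘ DoubleHole-∷)
... | w , refl , span≤n = one ∷ w , refl , s≤s span≤n
¬DoubleHole⇒landings (suc zero)    (false ∷ [])       _   = [] , refl , z≤n
¬DoubleHole⇒landings (suc (suc n)) (false ∷ true ∷ v) ¬dh
  with ¬DoubleHole⇒landings n v (¬dh ∘ DoubleHole-∷ ∘ DoubleHole-∷)
... | w , refl , span≤n = two ∷ w , refl , s≤s (s≤s span≤n)
¬DoubleHole⇒landings (suc (suc n)) (false ∷ false ∷ v) ¬dh with ⊥-or-member v
... | inj₁ refl       = [] , refl , z≤n
... | inj₂ (p , p∈)   = ⊥-elim (¬dh (doubleHole 0 1 (3 + p) refl p∈ z<s (s≤s (s≤s z<s)) refl refl))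

¬DoubleHole⇒walk : ∀ n (v : Subset n) → ¬ DoubleHole v → Σ ℕ (λ p → mem v p ≡ true) →
                   Σ ℕ λ s → Σ (List Step) λ w → v ≡ walk n s w × Fits n s w
¬DoubleHole⇒walk (suc n) (true ∷ v)  ¬dh _ with ¬DoubleHole⇒landings n v ¬dh
... | w , refl , span≤n = 0 , w , refl , s≤s span≤n
¬DoubleHole⇒walk (suc n) (false ∷ v) ¬dh (suc p , p∈) with ¬DoubleHole⇒walk n v (¬dh ∘ DoubleHole-∷) (p , p∈)
... | s , w , refl , fits = suc s , w , refl , s≤s fits

¬Hole⇒landings-ones : ∀ n (v : Subset n) → ¬ Hole (true ∷ v) →
                      Σ ℕ λ k → v ≡ landings n (ones k) × span (ones k) ≤ n
¬Hole⇒landings-ones zero    []          _  = 0 , refl , z≤n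
¬Hole⇒landings-ones (suc n) (true ∷ v)  ¬h with ¬Hole⇒landings-ones n v (¬h ∘ Hole-∷)
... | k , refl , span≤n = suc k , refl , s≤s span≤n
¬Hole⇒landings-ones (suc n) (false ∷ v) ¬h with ⊥-or-member v
... | inj₁ refl       = 0 , refl , z≤n
... | inj₂ (p , p∈)   = ⊥-elim (¬h (hole 0 1 (2 + p) refl p∈ z<s (s≤s z<s) refl))

¬Hole⇒walk-ones : ∀ n (v : Subset n) → ¬ Hole v → Σ ℕ (λ p → mem v p ≡ true) →
                  Σ ℕ λ s → Σ ℕ λ k → v ≡ walk n s (ones k) × Fits n s (ones k)
¬Hole⇒walk-ones (suc n) (true ∷ v)  ¬h _ with ¬Hole⇒landings-ones n v ¬h
... | k , refl , span≤n = 0 , k , refl , s≤s span≤n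
¬Hole⇒walk-ones (suc n) (false ∷ v) ¬h (suc p , p∈) with ¬Hole⇒walk-ones n v (¬h ∘ Hole-∷) (p , p∈)
... | s , k , refl , fits = suc s , k , refl , s≤s fits

-- Enumerating connected sets and intervals

words : ℕ → ℕ → List (List Step)
words zero    zero    = [] ∷ []
words zero    (suc j) = []
words (suc l) zero    = map (one ∷_) (words l zero)
words (suc l) (suc j) = map (one ∷_) (words l (suc j)) ++ map (two ∷_) (words l j)

length-words : ∀ l j → length (words l j) ≡ l choose j
length-words zero    zero    = refl
length-words zero    (suc j) = refl
length-words (suc l) zero    = trans (length-map (one ∷_) (words l zero)) (length-words l zero)
length-words (suc l) (suc j) = begin
  length (map (one ∷_) (words l (suc j)) ++ map (two ∷_) (words l j))
    ≡⟨ length-++ (map (one ∷_) (words l (suc j))) ⟩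
  length (map (one ∷_) (words l (suc j))) + length (map (two ∷_) (words l j))
    ≡⟨ cong₂ _+_ (trans (length-map _ (words l (suc j))) (length-words l (suc j)))
                 (trans (length-map _ (words l j)) (length-words l j)) ⟩
  l choose suc j + l choose j
    ≡⟨ +-comm (l choose suc j) (l choose j) ⟩
  l choose j + l choose suc j
    ≡⟨ nCk+nC[k+1]≡[n+1]C[k+1] l j ⟩
  suc l choose suc j ∎
  where open ≡-Reasoning

Unique-words : ∀ l j → Unique (words l j)
Unique-words zero    zero    = All.[] ∷ []
Unique-words zero    (suc j) = []
Unique-words (suc l) zero    = Unique.map⁺ List.∷-injectiveʳ (Unique-words l zero)
Unique-words (suc l) (suc j) =
  Unique.++⁺ (Unique.map⁺ List.∷-injectiveʳ (Unique-words l (suc j)))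
             (Unique.map⁺ List.∷-injectiveʳ (Unique-words l j)) disjoint
  where
  disjoint : Disjoint (map (one ∷_) (words l (suc j))) (map (two ∷_) (words l j))
  disjoint (v∈ , v∈′) with ∈-map⁻ _ v∈ | ∈-map⁻ _ v∈′
  ... | _ , _ , refl | _ , _ , ()

∈-words⁻ : ∀ l j {w} → w ∈ₗ words l j → length w ≡ l × twos w ≡ j
∈-words⁻ zero    zero    (here refl) = refl , refl
∈-words⁻ (suc l) zero    w∈ with ∈-map⁻ _ w∈
... | w , w∈′ , refl = Product.map₁ (cong suc) (∈-words⁻ l zero w∈′)
∈-words⁻ (suc l) (suc j) w∈ with ∈-++⁻ (map (one ∷_) (words l (suc j))) w∈
... | inj₁ w∈₁ with ∈-map⁻ _ w∈₁
...   | w , w∈′ , refl = Product.map₁ (cong suc) (∈-words⁻ l (suc j) w∈′)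
∈-words⁻ (suc l) (suc j) w∈ | inj₂ w∈₂ with ∈-map⁻ _ w∈₂
...   | w , w∈′ , refl = Product.map (cong suc) (cong suc) (∈-words⁻ l j w∈′)

∈-words⁺ : ∀ w → w ∈ₗ words (length w) (twos w)
∈-words⁺ []        = here refl
∈-words⁺ (one ∷ w) with twos w | ∈-words⁺ w
... | zero  | w∈ = ∈-map⁺ (one ∷_) w∈
... | suc _ | w∈ = ∈-++⁺ˡ (∈-map⁺ (one ∷_) w∈)
∈-words⁺ (two ∷ w) = ∈-++⁺ʳ (map (one ∷_) (words (length w) (suc (twos w)))) (∈-map⁺ (two ∷_) (∈-words⁺ w))

starts : ℕ → List Step → List (ℕ × List Step)
starts m w = map (_, w) (upTo m)

codesWithTwos : ℕ → ℕ → ℕ → List (ℕ × List Step)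
codesWithTwos k n j = concatMap (starts (n ∸ k ∸ j + 1)) (words (k ∸ 1) j)

connectedCodes : ℕ → ℕ → List (ℕ × List Step)
connectedCodes k n = concatMap (codesWithTwos k n) (upTo (suc ((k ∸ 1) ⊓ (n ∸ k))))

length-connectedCodes : ∀ k n → length (connectedCodes k n) ≡ z k n
length-connectedCodes k n = begin
  length (connectedCodes k n)                              ≡⟨ length-concatMap (codesWithTwos k n) js ⟩
  sum (map (length ∘ codesWithTwos k n) js)                ≡⟨ cong sum (List.map-cong length-codesWithTwos js) ⟩
  sum (map (λ j → ((k ∸ 1) choose j) * (n ∸ k ∸ j + 1)) js) ∎
  where
  open ≡-Reasoning
  js = upTo (suc ((k ∸ 1) ⊓ (n ∸ k)))
  length-codesWithTwos : ∀ j → length (codesWithTwos k n j) ≡ ((k ∸ 1) choose j) * (n ∸ k ∸ j + 1)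
  length-codesWithTwos j = begin
    length (codesWithTwos k n j)                               ≡⟨ length-concatMap (starts m) (words (k ∸ 1) j) ⟩
    sum (map (length ∘ starts m) (words (k ∸ 1) j))           ≡⟨ sum-map-const _ (words (k ∸ 1) j) length-starts ⟩
    length (words (k ∸ 1) j) * m                               ≡⟨ cong (_* m) (length-words (k ∸ 1) j) ⟩
    ((k ∸ 1) choose j) * m                                     ∎
    where
    m = n ∸ k ∸ j + 1
    length-starts : ∀ w → length (starts m w) ≡ m
    length-starts w = trans (length-map (_, w) (upTo m)) (length-upTo m)

Unique-connectedCodes : ∀ k n → Unique (connectedCodes k n)
Unique-connectedCodes k n =
  Unique-concatMap⁺ (twos ∘ proj₂) twos-∈ (Unique.upTo⁺ (suc ((k ∸ 1) ⊓ (n ∸ k)))) λ j →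
  Unique-concatMap⁺ proj₂ proj₂-∈ (Unique-words (k ∸ 1) j) λ w →
  Unique.map⁺ (cong proj₁) (Unique.upTo⁺ (n ∸ k ∸ j + 1))
  where
  proj₂-∈ : ∀ {m w c} → c ∈ₗ starts m w → proj₂ c ≡ w
  proj₂-∈ c∈ with ∈-map⁻ _ c∈
  ... | _ , _ , refl = refl
  twos-∈ : ∀ {j c} → c ∈ₗ codesWithTwos k n j → twos (proj₂ c) ≡ j
  twos-∈ {j} c∈ with ∈-concatMap⁻′ (starts _) c∈
  ... | w , w∈ , c∈′ = trans (cong twos (proj₂-∈ c∈′)) (proj₂ (∈-words⁻ (k ∸ 1) j w∈))

code-range⇒bound : ∀ {k n j s} → k ≤ n → j ≤ n ∸ k → s < n ∸ k ∸ j + 1 → s + (k + j) ≤ n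
code-range⇒bound {k} {n} {j} {s} k≤n j≤n∸k s<n∸k∸j+1 =
  m≤o∸n⇒m+n≤o s (subst (_≤ n) (+-comm j k) (m≤o∸n⇒m+n≤o j k≤n j≤n∸k))
    (subst (s ≤_) (∸-+-assoc n k j) (m<1+n⇒m≤n (subst (s <_) (+-comm _ 1) s<n∸k∸j+1)))

bound⇒code-range : ∀ {k n j s} → s + (k + j) ≤ n → j ≤ n ∸ k × s < n ∸ k ∸ j + 1
bound⇒code-range {k} {n} {j} {s} s+k+j≤n =
  m+n≤o⇒m≤o∸n j (subst (_≤ n) (+-comm k j) (m+n≤o⇒n≤o s s+k+j≤n)) ,
  subst (s <_) (+-comm 1 _) (s≤s (subst (s ≤_) (sym (∸-+-assoc n k j)) (m+n≤o⇒m≤o∸n s s+k+j≤n)))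

Fits⇔bound : ∀ {n s} w → Fits n s w ⇔ s + (suc (length w) + twos w) ≤ n
Fits⇔bound {n} {s} w = mk⇔ (subst (λ t → s + suc t ≤ n) (span≡length+twos w))
                           (subst (λ t → s + suc t ≤ n) (sym (span≡length+twos w)))

∈-connectedCodes⁻ : ∀ {K n s w} → suc K ≤ n → (s , w) ∈ₗ connectedCodes (suc K) n → Fits n s w × length w ≡ K
∈-connectedCodes⁻ {K} {n} {s} {w} k≤n c∈
  with ∈-concatMap⁻′ (codesWithTwos (suc K) n) {upTo (suc (K ⊓ (n ∸ suc K)))} c∈
... | j , j∈ , c∈′ with ∈-concatMap⁻′ (starts (n ∸ suc K ∸ j + 1)) {words K j} c∈′
...   | w′ , w′∈ , c∈″ with ∈-map⁻ (_, w′) c∈″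
...     | s′ , s∈ , refl with ∈-words⁻ K j w′∈
...       | refl , refl =
  Equivalence.from (Fits⇔bound w)
    (code-range⇒bound k≤n (≤-trans (m<1+n⇒m≤n (∈-upTo⁻ j∈)) (m⊓n≤n K _)) (∈-upTo⁻ s∈)) ,
  refl

∈-connectedCodes⁺ : ∀ {K n s w} → Fits n s w → length w ≡ K → (s , w) ∈ₗ connectedCodes (suc K) n
∈-connectedCodes⁺ {n = n} {s} {w} fits refl with bound⇒code-range (Equivalence.to (Fits⇔bound w) fits)
... | j≤n∸k , s<n∸k∸j+1 =
  ∈-concatMap⁺′ (codesWithTwos (suc (length w)) n) (∈-upTo⁺ (s≤s (⊓-glb (twos≤length w) j≤n∸k)))
    (∈-concatMap⁺′ (starts _) (∈-words⁺ w) (∈-map⁺ (_, w) (∈-upTo⁺ s<n∸k∸j+1)))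

count-connected : ∀ K n → suc K ≤ n →
                  HasCount (λ C → InducedConnected SqPathAdj C × ∣ C ∣ ≡ suc K) (z (suc K) n)
count-connected K n k≤n = subst (HasCount _) (length-connectedCodes (suc K) n)
  (HasCount-image (uncurry (walk n)) codes (Unique-connectedCodes (suc K) n) injective sound complete)
  where
  codes = connectedCodes (suc K) n
  injective : ∀ {c c′} → c ∈ₗ codes → c′ ∈ₗ codes → uncurry (walk n) c ≡ uncurry (walk n) c′ → c ≡ c′
  injective c∈ c′∈ e with walk-injective n (proj₁ (∈-connectedCodes⁻ k≤n c∈)) (proj₁ (∈-connectedCodes⁻ k≤n c′∈)) e
  ... | refl , refl = refl
  sound : ∀ {c} → c ∈ₗ codes →
          InducedConnected SqPathAdj (uncurry (walk n) c) × ∣ uncurry (walk n) c ∣ ≡ suc K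
  sound {s , w} c∈ with ∈-connectedCodes⁻ k≤n c∈
  ... | fits , refl = ¬DoubleHole⇒connected (¬DoubleHole-walk n s w) , ∣walk∣ n s w fits
  complete : ∀ {C} → InducedConnected SqPathAdj C × ∣ C ∣ ≡ suc K →
             Σ (ℕ × List Step) λ c → c ∈ₗ codes × uncurry (walk n) c ≡ C
  complete {C} (conn , ∣C∣≡1+K)
    with ¬DoubleHole⇒walk n C (connected⇒¬DoubleHole conn)
           (nonempty⇒member C (subst (1 ≤_) (sym ∣C∣≡1+K) (s≤s z≤n)))
  ... | s , w , refl , fits =
    (s , w) , ∈-connectedCodes⁺ fits (suc-injective (trans (sym (∣walk∣ n s w fits)) ∣C∣≡1+K)) , refl

Fits-ones⇔ : ∀ {n s k} → k ≤ n → Fits n s (ones k) ⇔ s < n ∸ k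
Fits-ones⇔ {n} {s} {k} k≤n = mk⇔
  (λ fits → m+n≤o⇒m≤o∸n (suc s) (subst (_≤ n) s+1+k≡1+s+k fits))
  (λ s<n∸k → subst (_≤ n) (sym s+1+k≡1+s+k) (m≤o∸n⇒m+n≤o (suc s) k≤n s<n∸k))
  where
  s+1+k≡1+s+k : s + suc (span (ones k)) ≡ suc s + k
  s+1+k≡1+s+k = trans (cong (λ t → s + suc t) (span-ones k)) (+-suc s k)

count-intervals : ∀ k n → k ≤ n → HasCount (λ C → ¬ Hole C × ∣ C ∣ ≡ suc k) (n ∸ k)
count-intervals k n k≤n = subst (HasCount _) (length-upTo (n ∸ k))
  (HasCount-image interval (upTo (n ∸ k)) (Unique.upTo⁺ (n ∸ k)) injective sound complete)
  where
  interval : ℕ → Subset n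
  interval s = walk n s (ones k)
  fits : ∀ {s} → s ∈ₗ upTo (n ∸ k) → Fits n s (ones k)
  fits s∈ = Equivalence.from (Fits-ones⇔ k≤n) (∈-upTo⁻ s∈)
  ∣interval∣ : ∀ {s k′} → Fits n s (ones k′) → ∣ walk n s (ones k′) ∣ ≡ suc k′
  ∣interval∣ {s} {k′} fits′ = trans (∣walk∣ n s (ones k′) fits′) (cong suc (length-replicate k′))
  injective : ∀ {s s′} → s ∈ₗ upTo (n ∸ k) → s′ ∈ₗ upTo (n ∸ k) → interval s ≡ interval s′ → s ≡ s′
  injective s∈ s′∈ e = proj₁ (walk-injective n (fits s∈) (fits s′∈) e)
  sound : ∀ {s} → s ∈ₗ upTo (n ∸ k) → ¬ Hole (interval s) × ∣ interval s ∣ ≡ suc k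
  sound {s} s∈ = ¬Hole-walk-ones n s k , ∣interval∣ (fits s∈)
  complete : ∀ {C} → ¬ Hole C × ∣ C ∣ ≡ suc k → Σ ℕ λ s → s ∈ₗ upTo (n ∸ k) × interval s ≡ C
  complete {C} (¬h , ∣C∣≡1+k)
    with ¬Hole⇒walk-ones n C ¬h (nonempty⇒member C (subst (1 ≤_) (sym ∣C∣≡1+k) (s≤s z≤n)))
  ... | s , k′ , refl , fits′ with suc-injective (trans (sym (∣interval∣ fits′)) ∣C∣≡1+k)
  ...   | refl = s , ∈-upTo⁺ (Equivalence.to (Fits-ones⇔ k≤n) fits′) , refl

proposition3p6 : (k n : ℕ) → 2 ≤ k → k + 2 ≤ n →
    QCount (SqPathAdj {n}) k k (z k n) ×
    QCount (SqPathAdj {n}) k (k + 1) (n ∸ k) ×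
    (∀ m → k + 2 ≤ m → QCount (SqPathAdj {n}) k m 0)
proposition3p6 k@(suc K) n 2≤k k+2≤n =
  HasCount-sized refl connected⇔KBad-of-size (count-connected K n k≤n) ,
  HasCount-sized (+-comm 1 k) (¬Hole⇔KBad-of-size-suc 2≤k) (count-intervals k n k≤n) ,
  λ m k+2≤m → HasCount-none λ C (C-bad , ∣C∣≡m) → ¬KBad-large 2≤k (subst (k + 2 ≤_) (sym ∣C∣≡m) k+2≤m) C-bad
  where
  k≤n : k ≤ n
  k≤n = ≤-trans (m≤m+n k 2) k+2≤n
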